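{- Let $G$ be a finite simple graph, let $T$ be a clique in $G$, and let $z$ be a vertex of $T$ with $\deg(z)=|T|-1$. Suppose that $z$ is not the only vertex of $T$ of degree $|T|-1$, that some vertex in $T$ has a neighbor outside of $T$, and that for each vertex in $T$, its set of neighbors outside of $T$ is either empty or forms a clique. Then $z$ is a critical vertex.
   Context: Zero forcing rule: a filled vertex $v$ forces an unfilled vertex $u$ if $u$ is the only unfilled neighbor of $v$; each vertex forces at most once. A zero forcing set is an initially filled set from which repeated forcing fills all vertices; $Z(G)$ is the minimum size of a zero forcing set, and a zero forcing set of that size is optimal. An optimal forcing sequence is a sequence of valid forces from an optimal zero forcing set after which no further forces are possible. A vertex is critical if there exists an optimal forcing sequence in which it neither forces nor gets forced. -}

module Defs where

open import Data.Nat using (ℕ; _≤_; _∸_)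
open import Data.Fin using (Fin)
open import Data.Fin.Subset using (Subset; _∈_; _∉_; _∪_; ⁅_⁆; ∣_∣)
open import Data.Vec using (tabulate)
open import Data.List using (List; []; _∷_)
open import Data.List.Relation.Unary.Any using (Any)
import Data.List.Membership.Propositional as LM
open import Data.Product using (Σ; ∃; ∃-syntax; _×_; _,_; proj₁; proj₂)
open import Data.Sum using (_⊎_)
open import Data.Unit using (⊤)
open import Relation.Nullary using (¬_; Dec; does)
open import Relation.Binary.PropositionalEquality using (_≡_; _≢_)

record Graph (n : ℕ) : Set₁ where
  field
    Adj   : Fin n → Fin n → Set
    adj?  : ∀ x y → Dec (Adj x y)
    sym   : ∀ {x y} → Adj x y → Adj y x
    irrefl : ∀ {x} → ¬ Adj x x
open Graph public

module _ {n : ℕ} (G : Graph n) where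

  N : Fin n → Subset n
  N v = tabulate (λ w → does (adj? G v w))

  deg : Fin n → ℕ
  deg v = ∣ N v ∣

  IsClique : (Fin n → Set) → Set
  IsClique P = ∀ x y → P x → P y → x ≢ y → Adj G x y

  -- v (filled, not having forced yet) forces u in the current state
  -- (F = filled set, used = vertices that have already forced).
  Force : Subset n → List (Fin n) → Fin n → Fin n → Set
  Force F used v u =
    v ∈ F × u ∉ F × Adj G v u × (∀ w → Adj G v w → w ∉ F → w ≡ u)
    × ¬ (v LM.∈ used)

  Valid : Subset n → List (Fin n) → List (Fin n × Fin n) → Set
  Valid F used [] = ⊤
  Valid F used ((v , u) ∷ fs) = Force F used v u × Valid (F ∪ ⁅ u ⁆) (v ∷ used) fs

  finalFilled : Subset n → List (Fin n × Fin n) → Subset n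
  finalFilled F [] = F
  finalFilled F ((v , u) ∷ fs) = finalFilled (F ∪ ⁅ u ⁆) fs

  finalUsed : List (Fin n) → List (Fin n × Fin n) → List (Fin n)
  finalUsed used [] = used
  finalUsed used ((v , u) ∷ fs) = finalUsed (v ∷ used) fs

  IsZeroForcingSet : Subset n → Set
  IsZeroForcingSet S =
    ∃[ fs ] (Valid S [] fs × (∀ v → v ∈ finalFilled S fs))

  IsOptimalZFS : Subset n → Set
  IsOptimalZFS S =
    IsZeroForcingSet S × (∀ S′ → IsZeroForcingSet S′ → ∣ S ∣ ≤ ∣ S′ ∣)

  Terminal : Subset n → List (Fin n × Fin n) → Set
  Terminal S fs = ∀ v u → ¬ Force (finalFilled S fs) (finalUsed [] fs) v u

  IsOptimalForcingSeq : Subset n → List (Fin n × Fin n) → Set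
  IsOptimalForcingSeq S fs = IsOptimalZFS S × Valid S [] fs × Terminal S fs

  Uninvolved : Fin n → List (Fin n × Fin n) → Set
  Uninvolved z fs = ¬ Any (λ p → proj₁ p ≡ z ⊎ proj₂ p ≡ z) fs

  IsCritical : Fin n → Set
  IsCritical z = ∃[ S ] ∃[ fs ] (IsOptimalForcingSeq S fs × Uninvolved z fs)

{-# OPTIONS --safe #-}
module Submission where

-- Call a set C of vertices stalled when no vertex of C that may force has exactly one
-- neighbour outside C.  Forcing from S never leaves a stalled superset of S and, run
-- greedily, ends in one; so S is a zero forcing set iff every stalled superset of S is
-- everything.  The vertices z and z′ are closed twins with closed neighbourhood T, so an
-- optimal zero forcing set contains one of them and may be taken to contain z.  Forbid z
-- to force.  If forcing still fills the graph we are done.  Otherwise it stalls with z′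
-- the only unfilled vertex of T, and since the outside neighbourhoods of vertices of T are
-- cliques, no vertex of T other than z, z′ was ever forced: they all lie in S.  Exchanging
-- one of them, x₀, for z′ gives a set of the same size from which z′ forces x₀, after
-- which the graph fills without z ever forcing.

open import Defs
open import Data.Empty using (⊥-elim)
open import Data.Fin using (Fin; zero; suc)
open import Data.Fin.Properties using (_≟_; any?; all?)
open import Data.Fin.Subset using (Subset; _∈_; _∉_; ∣_∣; _∪_; ⁅_⁆; _-_; _⊂_; ⊤; inside; outside)
open import Data.Fin.Subset.Properties
  using (_∈?_; x∈p∪q⁺; x∈p∪q⁻; x∈⁅x⁆; x∈⁅y⁆⇒x≡y; x∈p∧x≢y⇒x∈p-y; x∈p⇒∣p-x∣<∣p∣;
         p⊂q⇒∣p∣<∣q∣; ∣p∣≤n; ∣p∣≡n⇒p≡⊤; ∈⊤; anySubset?; ∪-identityʳ)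
open import Data.List using (List; []; _∷_)
open import Data.List.Relation.Unary.All using (All; []; _∷_; universal)
open import Data.List.Relation.Unary.Any using (here; there)
open import Data.List.Membership.Propositional using () renaming (_∈_ to _∈ₗ_)
open import Data.Nat using (ℕ; zero; suc; _+_; _∸_; _≤_; _<?_; s≤s; z≤n; pred; >-nonZero)
open import Data.Nat.Properties
  using (≤-refl; ≤-trans; ≤-antisym; <-≤-trans; <-irrefl; ≮⇒≥; n≮0; ≤-pred; n≤1+n;
         m≤n+m; +-identityʳ; +-suc; +-monoˡ-≤; suc-pred; module ≤-Reasoning)
open import Data.Product using (∃-syntax; _×_; _,_; proj₁; proj₂)
open import Data.Sum using (_⊎_; inj₁; inj₂)
open import Data.Unit using (tt)
open import Data.Vec using (_∷_)
open import Data.Vec.Properties using (lookup⇒[]=; lookup∘tabulate)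
open import Level using (0ℓ)
open import Relation.Nullary using (¬_; Dec; yes; no)
open import Relation.Nullary.Decidable using (dec-true; decidable-stable; ¬?; _×-dec_; _⊎-dec_; _→-dec_)
open import Relation.Binary.PropositionalEquality using (_≡_; _≢_; refl; trans; cong; subst; ≢-sym)
import Relation.Binary.PropositionalEquality as ≡
open import Relation.Unary using (Pred; Decidable; Universal; _⊆_; ∅; ｛_｝)
open import Relation.Unary.Properties using (∅?)

∣p∪⁅x⁆∣≤1+∣p∣ : ∀ {m} (p : Subset m) x → ∣ p ∪ ⁅ x ⁆ ∣ ≤ suc ∣ p ∣
∣p∪⁅x⁆∣≤1+∣p∣ (inside  ∷ p) zero    rewrite ∪-identityʳ p = n≤1+n _
∣p∪⁅x⁆∣≤1+∣p∣ (outside ∷ p) zero    rewrite ∪-identityʳ p = ≤-refl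
∣p∪⁅x⁆∣≤1+∣p∣ (inside  ∷ p) (suc x) = s≤s (∣p∪⁅x⁆∣≤1+∣p∣ p x)
∣p∪⁅x⁆∣≤1+∣p∣ (outside ∷ p) (suc x) = ∣p∪⁅x⁆∣≤1+∣p∣ p x

exchange : ∀ {m} → Subset m → Fin m → Fin m → Subset m
exchange p x y = (p - x) ∪ ⁅ y ⁆

y∈exchange : ∀ {m} (p : Subset m) x y → y ∈ exchange p x y
y∈exchange p x y = x∈p∪q⁺ (inj₂ (x∈⁅x⁆ y))

w∈p∧w≢x⇒w∈exchange : ∀ {m} {p : Subset m} {x y w} → w ∈ p → w ≢ x → w ∈ exchange p x y
w∈p∧w≢x⇒w∈exchange w∈p w≢x = x∈p∪q⁺ (inj₁ (x∈p∧x≢y⇒x∈p-y w∈p w≢x))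

∣exchange∣≤∣p∣ : ∀ {m} {p : Subset m} {x} y → x ∈ p → ∣ exchange p x y ∣ ≤ ∣ p ∣
∣exchange∣≤∣p∣ {p = p} {x} y x∈p = ≤-trans (∣p∪⁅x⁆∣≤1+∣p∣ (p - x) y) (x∈p⇒∣p-x∣<∣p∣ x∈p)

Px∧¬Py⇒x≢y : ∀ {a ℓ} {A : Set a} (P : Pred A ℓ) {x y} → P x → ¬ P y → x ≢ y
Px∧¬Py⇒x≢y P Px ¬Py refl = ¬Py Px

module _ {n : ℕ} (G : Graph n) where

  open import Data.List.Membership.DecPropositional (_≟_ {n}) using () renaming (_∈?_ to _∈ₗ?_)

  adj⇒∈N : ∀ {v w} → Adj G v w → w ∈ N G v
  adj⇒∈N {v} {w} vw = lookup⇒[]= w (N G v) (trans (lookup∘tabulate _ w) (dec-true (adj? G v w) vw))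

  Stalled : Pred (Fin n) 0ℓ → Pred (Fin n) 0ℓ → Set
  Stalled Ban C = ∀ {v u} → C v → ¬ Ban v → ¬ C u → Adj G v u → ∃[ w ] (w ≢ u × Adj G v w × ¬ C w)

  ForcersOutside : Pred (Fin n) 0ℓ → List (Fin n × Fin n) → Set
  ForcersOutside Ban = All (λ force → ¬ Ban (proj₁ force))

  NoProperStalledSuperset : Pred (Fin n) 0ℓ → Subset n → Set₁
  NoProperStalledSuperset Ban S = ∀ {C} → Decidable C → Stalled Ban C → (_∈ S) ⊆ C → Universal C

  SizeAtMostZ : Subset n → Set
  SizeAtMostZ S = ∀ S′ → IsZeroForcingSet G S′ → ∣ S ∣ ≤ ∣ S′ ∣

  force? : ∀ F used v u → Dec (Force G F used v u)
  force? F used v u =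
    (v ∈? F) ×-dec ¬? (u ∈? F) ×-dec adj? G v u
    ×-dec all? (λ w → adj? G v w →-dec ¬? (w ∈? F) →-dec (w ≟ u))
    ×-dec ¬? (v ∈ₗ? used)

  ⊆-finalFilled : ∀ {F} fs → (_∈ F) ⊆ (_∈ finalFilled G F fs)
  ⊆-finalFilled []             x∈F = x∈F
  ⊆-finalFilled ((_ , _) ∷ fs) x∈F = ⊆-finalFilled fs (x∈p∪q⁺ (inj₁ x∈F))

  finalFilled⊆stalled : ∀ {Ban C F used} → Decidable C → Stalled Ban C →
    ∀ fs → Valid G F used fs → ForcersOutside Ban fs → (_∈ F) ⊆ C → (_∈ finalFilled G F fs) ⊆ C
  finalFilled⊆stalled C? stalled []             _              _            F⊆C = F⊆C
  finalFilled⊆stalled {C = C} {F} C? stalled ((v , u) ∷ fs) ((v∈F , _ , vu , unique , _) , valid)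
                      (allowed ∷ avoid) F⊆C =
    finalFilled⊆stalled C? stalled fs valid avoid F∪u⊆C
    where
    Cu : C u
    Cu = decidable-stable (C? u) λ ¬Cu →
      let (w , w≢u , vw , ¬Cw) = stalled (F⊆C v∈F) allowed ¬Cu vu
      in w≢u (unique w vw (λ w∈F → ¬Cw (F⊆C w∈F)))
    F∪u⊆C : (_∈ F ∪ ⁅ u ⁆) ⊆ C
    F∪u⊆C {x} x∈F∪u with x∈p∪q⁻ F ⁅ u ⁆ x∈F∪u
    ... | inj₁ x∈F = F⊆C x∈F
    ... | inj₂ x∈u = subst C (≡.sym (x∈⁅y⁆⇒x≡y u x∈u)) Cu

  NeighboursFilled : Subset n → List (Fin n) → Set
  NeighboursFilled F used = ∀ {v w} → v ∈ₗ used → Adj G v w → w ∈ F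

  maximalSequence : ∀ {Ban} → Decidable Ban → ∀ k F used → NeighboursFilled F used → n ≤ ∣ F ∣ + k →
    ∃[ fs ] (Valid G F used fs × ForcersOutside Ban fs × Stalled Ban (_∈ finalFilled G F fs))
  maximalSequence Ban? zero F used _ n≤∣F∣ = [] , tt , [] , λ {_} {u} _ _ u∉F _ → ⊥-elim (u∉F (full u))
    where
    full : Universal (_∈ F)
    full x = subst (x ∈_) (≡.sym (∣p∣≡n⇒p≡⊤ (≤-antisym (∣p∣≤n F) (subst (n ≤_) (+-identityʳ _) n≤∣F∣)))) ∈⊤
  maximalSequence {Ban} Ban? (suc k) F used filled bound
    with any? (λ v → any? (λ u → ¬? (Ban? v) ×-dec force? F used v u))
  ... | yes (v , u , allowed , force@(_ , u∉F , vu , unique , _)) =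
    let (fs , valid , avoid , stalled) = maximalSequence Ban? k (F ∪ ⁅ u ⁆) (v ∷ used) filled′ bound′
    in (v , u) ∷ fs , (force , valid) , allowed ∷ avoid , stalled
    where
    filled′ : NeighboursFilled (F ∪ ⁅ u ⁆) (v ∷ used)
    filled′ (here refl) vw with _ ∈? F
    ... | yes w∈F = x∈p∪q⁺ (inj₁ w∈F)
    ... | no  w∉F = x∈p∪q⁺ (inj₂ (subst (_∈ ⁅ u ⁆) (≡.sym (unique _ vw w∉F)) (x∈⁅x⁆ u)))
    filled′ (there v′∈used) v′w = x∈p∪q⁺ (inj₁ (filled v′∈used v′w))
    bound′ : n ≤ ∣ F ∪ ⁅ u ⁆ ∣ + k
    bound′ = ≤-trans (subst (n ≤_) (+-suc ∣ F ∣ k) bound) (+-monoˡ-≤ k (p⊂q⇒∣p∣<∣q∣ F⊂F∪u))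
      where
      F⊂F∪u : F ⊂ F ∪ ⁅ u ⁆
      F⊂F∪u = (λ x∈F → x∈p∪q⁺ (inj₁ x∈F)) , u , x∈p∪q⁺ (inj₂ (x∈⁅x⁆ u)) , u∉F
  ... | no noForce = [] , tt , [] , stalled
    where
    stalled : Stalled Ban (_∈ F)
    stalled {v} {u} v∈F allowed u∉F vu
      with any? (λ w → ¬? (w ≟ u) ×-dec adj? G v w ×-dec ¬? (w ∈? F))
    ... | yes second = second
    ... | no  noSecond =
      ⊥-elim (noForce (v , u , allowed , v∈F , u∉F , vu , unique , λ v∈used → u∉F (filled v∈used vu)))
      where
      unique : ∀ w → Adj G v w → w ∉ F → w ≡ u
      unique w vw w∉F = decidable-stable (w ≟ u) λ w≢u → noSecond (w , w≢u , vw , w∉F)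

  FullSequence : Pred (Fin n) 0ℓ → Subset n → Set
  FullSequence Ban S =
    ∃[ fs ] (Valid G S [] fs × ForcersOutside Ban fs × Universal (_∈ finalFilled G S fs))

  fullSequence⇒noProperStalledSuperset : ∀ {Ban S} → FullSequence Ban S → NoProperStalledSuperset Ban S
  fullSequence⇒noProperStalledSuperset (fs , valid , avoid , full) C? stalled S⊆C x =
    finalFilled⊆stalled C? stalled fs valid avoid S⊆C (full x)

  zfs⇒noProperStalledSuperset : ∀ {S} → IsZeroForcingSet G S → NoProperStalledSuperset ∅ S
  zfs⇒noProperStalledSuperset (fs , valid , full) =
    fullSequence⇒noProperStalledSuperset (fs , valid , universal (λ _ ()) fs , full)

  StallingSequence : Pred (Fin n) 0ℓ → Subset n → Set
  StallingSequence Ban S =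
    ∃[ fs ] (Valid G S [] fs × ForcersOutside Ban fs × Stalled Ban (_∈ finalFilled G S fs))

  stallingSequence : ∀ {Ban} → Decidable Ban → ∀ S → StallingSequence Ban S
  stallingSequence Ban? S = maximalSequence Ban? n S [] (λ ()) (m≤n+m n ∣ S ∣)

  noProperStalledSuperset⇒fullSequence : ∀ {Ban S} → Decidable Ban →
    NoProperStalledSuperset Ban S → FullSequence Ban S
  noProperStalledSuperset⇒fullSequence {S = S} Ban? spans =
    let (fs , valid , avoid , stalled) = stallingSequence Ban? S
    in fs , valid , avoid , spans (_∈? _) stalled (⊆-finalFilled fs)

  zfs? : Decidable (IsZeroForcingSet G)
  zfs? S with stallingSequence ∅? S
  ... | fs , valid , _ , stalled with all? (_∈? finalFilled G S fs)
  ...   | yes full    = yes (fs , valid , full)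
  ...   | no  notFull =
    no λ zfs → notFull (zfs⇒noProperStalledSuperset zfs (_∈? _) stalled (⊆-finalFilled fs))

  optimalZFS : ∃[ S ] IsOptimalZFS G S
  optimalZFS = descend n ⊤ (∣p∣≤n ⊤) ([] , tt , λ _ → ∈⊤)
    where
    descend : ∀ k S → ∣ S ∣ ≤ k → IsZeroForcingSet G S → ∃[ S ] IsOptimalZFS G S
    descend k S ∣S∣≤k zfs with anySubset? (λ S′ → zfs? S′ ×-dec (∣ S′ ∣ <? ∣ S ∣))
    descend k       S ∣S∣≤k zfs | no noSmaller =
      S , zfs , λ S′ zfs′ → ≮⇒≥ λ smaller → noSmaller (S′ , zfs′ , smaller)
    descend zero    S ∣S∣≤k zfs | yes (_ , _ , smaller) = ⊥-elim (n≮0 (<-≤-trans smaller ∣S∣≤k))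
    descend (suc k) S ∣S∣≤k zfs | yes (S′ , zfs′ , smaller) =
      descend k S′ (≤-pred (<-≤-trans smaller ∣S∣≤k)) zfs′

  filled⇒uninvolved : ∀ {z F used} fs → Valid G F used fs → ForcersOutside ｛ z ｝ fs → z ∈ F →
    Uninvolved G z fs
  filled⇒uninvolved (_ ∷ _)  _                   (z≢v ∷ _) _   (here (inj₁ v≡z)) = z≢v (≡.sym v≡z)
  filled⇒uninvolved (_ ∷ _)  ((_ , u∉F , _) , _) _         z∈F (here (inj₂ refl)) = u∉F z∈F
  filled⇒uninvolved (_ ∷ fs) (_ , valid)         (_ ∷ avoid) z∈F (there involved) =
    filled⇒uninvolved fs valid avoid (x∈p∪q⁺ (inj₁ z∈F)) involved

  noProperStalledSuperset⇒critical : ∀ {z S} → z ∈ S → SizeAtMostZ S →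
    NoProperStalledSuperset ｛ z ｝ S → IsCritical G z
  noProperStalledSuperset⇒critical {z} {S} z∈S small spans =
    let (fs , valid , avoid , full) = noProperStalledSuperset⇒fullSequence (z ≟_) spans
    in S , fs , (((fs , valid , full) , small) , valid , λ { _ u (_ , u∉F , _) → u∉F (full u) })
           , filled⇒uninvolved fs valid avoid z∈S

  clique-degree⇒neighbours⊆ : ∀ {T z} → IsClique G (_∈ T) → z ∈ T → deg G z ≡ ∣ T ∣ ∸ 1 →
    ∀ {y} → Adj G z y → y ∈ T
  clique-degree⇒neighbours⊆ {T} {z} clique z∈T deg≡ {y} zy = decidable-stable (y ∈? T) λ y∉T →
    <-irrefl refl (begin-strict
      ∣ T ∣              <⟨ p⊂q⇒∣p∣<∣q∣ (T⊆N[z] , y , x∈p∪q⁺ (inj₁ (adj⇒∈N zy)) , y∉T) ⟩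
      ∣ N G z ∪ ⁅ z ⁆ ∣  ≤⟨ ∣p∪⁅x⁆∣≤1+∣p∣ (N G z) z ⟩
      suc (deg G z)      ≡⟨ cong suc deg≡ ⟩
      suc (pred ∣ T ∣)   ≡⟨ suc-pred ∣ T ∣ {{>-nonZero (≤-trans (s≤s z≤n) (x∈p⇒∣p-x∣<∣p∣ z∈T))}} ⟩
      ∣ T ∣              ∎)
    where
    open ≤-Reasoning
    T⊆N[z] : (_∈ T) ⊆ (_∈ N G z ∪ ⁅ z ⁆)
    T⊆N[z] {x} x∈T with x ≟ z
    ... | yes refl = x∈p∪q⁺ (inj₂ (x∈⁅x⁆ z))
    ... | no  x≢z  = x∈p∪q⁺ (inj₁ (adj⇒∈N (clique z x z∈T x∈T (≢-sym x≢z))))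

  unban-stalled : ∀ {z C} → Stalled ｛ z ｝ C →
    (∀ {u} → ¬ C u → Adj G z u → ∃[ w ] (w ≢ u × Adj G z w × ¬ C w)) → Stalled ∅ C
  unban-stalled {z} stalled stalledAtZ {v} Cv _ ¬Cu vu with z ≟ v
  ... | yes refl = stalledAtZ ¬Cu vu
  ... | no  z≢v  = stalled Cv z≢v ¬Cu vu

  record ClosedTwins (a b : Fin n) : Set where
    field
      adjacent : Adj G a b
      toʳ      : ∀ {v} → v ≢ b → Adj G a v → Adj G b v
      toˡ      : ∀ {v} → v ≢ a → Adj G b v → Adj G a v

    a≢b : a ≢ b
    a≢b refl = irrefl G adjacent

  exchange-twin : ∀ {a b S} → ClosedTwins a b → a ∉ S → b ∈ S →
    NoProperStalledSuperset ∅ S → NoProperStalledSuperset ∅ (exchange S b a)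
  exchange-twin {a} {b} {S} twins a∉S b∈S spans {D} D? stalled S′⊆D with D? b
  ... | yes Db = spans D? stalled S⊆D
    where
    S⊆D : (_∈ S) ⊆ D
    S⊆D {x} x∈S with x ≟ b
    ... | yes refl = Db
    ... | no  x≢b  = S′⊆D (w∈p∧w≢x⇒w∈exchange x∈S x≢b)
  ... | no ¬Db = ⊥-elim (¬C′a (spans C′? stalled′ S⊆C′ a))
    where
    open ClosedTwins twins
    Da : D a
    Da = S′⊆D (y∈exchange S b a)
    -- the image of D under the automorphism exchanging the twins
    C′ : Pred (Fin n) 0ℓ
    C′ x = x ≡ b ⊎ (x ≢ a × D x)
    C′? : Decidable C′
    C′? x = (x ≟ b) ⊎-dec (¬? (x ≟ a) ×-dec D? x)
    ¬C′a : ¬ C′ a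
    ¬C′a (inj₁ a≡b)       = a≢b a≡b
    ¬C′a (inj₂ (a≢a , _)) = a≢a refl
    ¬C′ : ∀ {w} → w ≢ b → ¬ D w → ¬ C′ w
    ¬C′ w≢b _   (inj₁ w≡b)      = w≢b w≡b
    ¬C′ _   ¬Dw (inj₂ (_ , Dw)) = ¬Dw Dw
    S⊆C′ : (_∈ S) ⊆ C′
    S⊆C′ {x} x∈S with x ≟ b
    ... | yes x≡b = inj₁ x≡b
    ... | no  x≢b = inj₂ ((λ { refl → a∉S x∈S }) , S′⊆D (w∈p∧w≢x⇒w∈exchange x∈S x≢b))
    stalled′ : Stalled ∅ C′
    stalled′ {u = u} (inj₁ refl) _ ¬C′u bu with u ≟ a
    ... | no  u≢a  = a , ≢-sym u≢a , sym G adjacent , ¬C′a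
    ... | yes refl =
      let (t , t≢b , at , ¬Dt) = stalled Da (λ ()) ¬Db adjacent
      in t , ≢-sym (Px∧¬Py⇒x≢y D Da ¬Dt) , toʳ t≢b at , ¬C′ t≢b ¬Dt
    stalled′ {v} {u} (inj₂ (v≢a , Dv)) _ ¬C′u vu with u ≟ a
    ... | yes refl =
      let (w , w≢b , vw , ¬Dw) = stalled Dv (λ ()) ¬Db (sym G (toʳ (Px∧¬Py⇒x≢y D Dv ¬Db) (sym G vu)))
      in w , ≢-sym (Px∧¬Py⇒x≢y D Da ¬Dw) , vw , ¬C′ w≢b ¬Dw
    ... | no u≢a with stalled Dv (λ ()) (λ Du → ¬C′u (inj₂ (u≢a , Du))) vu
    ...   | w , w≢u , vw , ¬Dw with w ≟ b
    ...     | yes refl = a , ≢-sym u≢a , sym G (toˡ v≢a (sym G vw)) , ¬C′a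
    ...     | no  w≢b  = w , w≢u , vw , ¬C′ w≢b ¬Dw

  twin-member : ∀ {a b S} → ClosedTwins a b → NoProperStalledSuperset ∅ S →
    ∃[ S′ ] (a ∈ S′ × ∣ S′ ∣ ≤ ∣ S ∣ × NoProperStalledSuperset ∅ S′)
  twin-member {a} {b} {S} twins spans with a ∈? S | b ∈? S
  ... | yes a∈S | _       = S , a∈S , ≤-refl , spans
  ... | no  a∉S | yes b∈S =
    exchange S b a , y∈exchange S b a , ∣exchange∣≤∣p∣ a b∈S , exchange-twin twins a∉S b∈S spans
  ... | no  a∉S | no  b∉S = ⊥-elim (proj₁ (spans C? stalled S⊆C a) refl)
    where
    open ClosedTwins twins
    C : Pred (Fin n) 0ℓ
    C x = x ≢ a × x ≢ b
    C? : Decidable C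
    C? x = ¬? (x ≟ a) ×-dec ¬? (x ≟ b)
    S⊆C : (_∈ S) ⊆ C
    S⊆C x∈S = (λ { refl → a∉S x∈S }) , (λ { refl → b∉S x∈S })
    stalled : Stalled ∅ C
    stalled {v} {u} (v≢a , v≢b) _ ¬Cu vu with u ≟ a | u ≟ b
    ... | yes refl | _        = b , ≢-sym a≢b , sym G (toʳ v≢b (sym G vu)) , λ (_ , b≢b) → b≢b refl
    ... | no  _    | yes refl = a , a≢b , sym G (toˡ v≢a (sym G vu)) , λ (a≢a , _) → a≢a refl
    ... | no  u≢a  | no  u≢b  = ⊥-elim (¬Cu (u≢a , u≢b))

module TwinsInClique {n : ℕ} (G : Graph n) {T : Subset n} {z z′ x₀ : Fin n}
  (clique : IsClique G (_∈ T)) (z∈T : z ∈ T) (z′∈T : z′ ∈ T) (x₀∈T : x₀ ∈ T)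
  (z′≢z : z′ ≢ z) (x₀≢z : x₀ ≢ z) (x₀≢z′ : x₀ ≢ z′)
  (N[z]⊆T : ∀ {y} → Adj G z y → y ∈ T) (N[z′]⊆T : ∀ {y} → Adj G z′ y → y ∈ T)
  (outside-cliques : ∀ x → x ∈ T → (∀ y → y ∉ T → ¬ Adj G x y) ⊎ IsClique G (λ y → y ∉ T × Adj G x y))
  where

  z≢z′ : z ≢ z′
  z≢z′ = ≢-sym z′≢z

  twins : ClosedTwins G z z′
  twins = record
    { adjacent = clique z z′ z∈T z′∈T z≢z′
    ; toʳ      = λ v≢z′ zv → clique z′ _ z′∈T (N[z]⊆T zv) (≢-sym v≢z′)
    ; toˡ      = λ v≢z z′v → clique z _ z∈T (N[z′]⊆T z′v) (≢-sym v≢z)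
    }

  stall-misses-only-z′ : ∀ {S C} → z ∈ S → NoProperStalledSuperset G ∅ S →
    Decidable C → Stalled G ｛ z ｝ C → (_∈ S) ⊆ C → ¬ Universal C →
    ¬ C z′ × (∀ {t} → t ∈ T → t ≢ z′ → C t)
  stall-misses-only-z′ {S} {C} z∈S spans C? stalled S⊆C notFull = ¬Cz′ , T-z′⊆C
    where
    -- With a second unfilled vertex in T, z could not force either, so C would be stalled outright.
    unique-gap : ¬ (∀ {u} → u ∈ T → ¬ C u → ∃[ w ] (w ∈ T × w ≢ u × ¬ C w))
    unique-gap second = notFull (spans C? (unban-stalled G stalled stalledAtZ) S⊆C)
      where
      stalledAtZ : ∀ {u} → ¬ C u → Adj G z u → ∃[ w ] (w ≢ u × Adj G z w × ¬ C w)
      stalledAtZ ¬Cu zu =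
        let (w , w∈T , w≢u , ¬Cw) = second (N[z]⊆T zu) ¬Cu
        in w , w≢u , clique z w z∈T w∈T (Px∧¬Py⇒x≢y C (S⊆C z∈S) ¬Cw) , ¬Cw
    ¬Cz′ : ¬ C z′
    ¬Cz′ Cz′ = unique-gap λ u∈T ¬Cu →
      let (w , w≢u , z′w , ¬Cw) = stalled Cz′ z≢z′ ¬Cu
                                          (clique z′ _ z′∈T u∈T (Px∧¬Py⇒x≢y C Cz′ ¬Cu))
      in w , N[z′]⊆T z′w , w≢u , ¬Cw
    T-z′⊆C : ∀ {t} → t ∈ T → t ≢ z′ → C t
    T-z′⊆C {t} t∈T t≢z′ = decidable-stable (C? t) λ ¬Ct → unique-gap λ {u} _ _ → case-z′ ¬Ct u
      where
      case-z′ : ¬ C t → ∀ u → ∃[ w ] (w ∈ T × w ≢ u × ¬ C w)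
      case-z′ ¬Ct u with u ≟ z′
      ... | yes refl = t , t∈T , t≢z′ , ¬Ct
      ... | no  u≢z′ = z′ , z′∈T , ≢-sym u≢z′ , ¬Cz′

  -- No vertex u of T other than z, z′ is forced while z′ is unfilled: a forcer in T also sees z′,
  -- and a forcer outside T also sees the second unfilled outside neighbour of u, as these form a clique.
  T-twins⊆initial : ∀ {S} fs → Valid G S [] fs → ForcersOutside G ｛ z ｝ fs →
    let F = finalFilled G S fs in
    Stalled G ｛ z ｝ (_∈ F) → z′ ∉ F → (∀ {t} → t ∈ T → t ≢ z′ → t ∈ F) →
    ∀ {t} → t ∈ T → t ≢ z → t ≢ z′ → t ∈ S
  T-twins⊆initial {S} fs valid avoid stalled z′∉F T-z′⊆F {t} t∈T t≢z t≢z′ =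
    decidable-stable (t ∈? S) λ t∉S →
      proj₂ (finalFilled⊆stalled G C? stalled′ fs valid avoid S⊆C (T-z′⊆F t∈T t≢z′)) (t∈T , t≢z , t≢z′ , t∉S)
    where
    F = finalFilled G S fs
    Missing : Pred (Fin n) 0ℓ
    Missing x = x ∈ T × x ≢ z × x ≢ z′ × x ∉ S
    Missing? : Decidable Missing
    Missing? x = (x ∈? T) ×-dec ¬? (x ≟ z) ×-dec ¬? (x ≟ z′) ×-dec ¬? (x ∈? S)
    C : Pred (Fin n) 0ℓ
    C x = x ∈ F × ¬ Missing x
    C? : Decidable C
    C? x = (x ∈? F) ×-dec ¬? (Missing? x)
    S⊆C : (_∈ S) ⊆ C
    S⊆C x∈S = ⊆-finalFilled G fs x∈S , λ (_ , _ , _ , x∉S) → x∉S x∈S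
    stalled′ : Stalled G ｛ z ｝ C
    stalled′ {v} {u} (v∈F , _) z≢v ¬Cu vu with u ∈? F
    ... | no u∉F =
      let (w , w≢u , vw , w∉F) = stalled v∈F z≢v u∉F vu in w , w≢u , vw , λ Cw → w∉F (proj₁ Cw)
    ... | yes u∈F with decidable-stable (Missing? u) (λ ¬missing → ¬Cu (u∈F , ¬missing)) | v ∈? T
    ...   | (u∈T , u≢z , u≢z′ , _) | yes v∈T =
      z′ , ≢-sym u≢z′ , clique v z′ v∈T z′∈T (Px∧¬Py⇒x≢y (_∈ F) v∈F z′∉F) , λ Cz′ → z′∉F (proj₁ Cz′)
    ...   | (u∈T , u≢z , u≢z′ , _) | no v∉T
      with stalled u∈F (≢-sym u≢z) z′∉F (clique u z′ u∈T z′∈T u≢z′) | outside-cliques u u∈T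
    ...     | _ | inj₁ isolated = ⊥-elim (isolated v v∉T (sym G vu))
    ...     | w , w≢z′ , uw , w∉F | inj₂ outsideClique =
      let w∉T = λ w∈T → w∉F (T-z′⊆F w∈T w≢z′)
      in w , ≢-sym (Px∧¬Py⇒x≢y (_∈ F) u∈F w∉F) ,
         outsideClique v w (v∉T , sym G vu) (w∉T , uw) (Px∧¬Py⇒x≢y (_∈ F) v∈F w∉F) ,
         λ Cw → w∉F (proj₁ Cw)

  exchange-x₀ : ∀ {S} → z ∈ S → (∀ {t} → t ∈ T → t ≢ z → t ≢ z′ → t ∈ S) →
    NoProperStalledSuperset G ∅ S → NoProperStalledSuperset G ｛ z ｝ (exchange S x₀ z′)
  exchange-x₀ {S} z∈S T-twins⊆S spans {D} D? stalled S′⊆D =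
    spans D? (unban-stalled G stalled λ ¬Du zu → ⊥-elim (¬Du (T⊆D (N[z]⊆T zu)))) S⊆D
    where
    Dz′ : D z′
    Dz′ = S′⊆D (y∈exchange S x₀ z′)
    T-x₀⊆D : ∀ {t} → t ∈ T → t ≢ x₀ → D t
    T-x₀⊆D {t} t∈T t≢x₀ with t ≟ z | t ≟ z′
    ... | yes refl | _        = S′⊆D (w∈p∧w≢x⇒w∈exchange z∈S t≢x₀)
    ... | no  _    | yes refl = Dz′
    ... | no  t≢z  | no  t≢z′ = S′⊆D (w∈p∧w≢x⇒w∈exchange (T-twins⊆S t∈T t≢z t≢z′) t≢x₀)
    Dx₀ : D x₀
    Dx₀ = decidable-stable (D? x₀) λ ¬Dx₀ →
      let (w , w≢x₀ , z′w , ¬Dw) = stalled Dz′ z≢z′ ¬Dx₀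
                                           (clique z′ x₀ z′∈T x₀∈T (≢-sym x₀≢z′))
      in ¬Dw (T-x₀⊆D (N[z′]⊆T z′w) w≢x₀)
    T⊆D : (_∈ T) ⊆ D
    T⊆D {t} t∈T with t ≟ x₀
    ... | yes refl = Dx₀
    ... | no  t≢x₀ = T-x₀⊆D t∈T t≢x₀
    S⊆D : (_∈ S) ⊆ D
    S⊆D {x} x∈S with x ≟ x₀
    ... | yes refl = Dx₀
    ... | no  x≢x₀ = S′⊆D (w∈p∧w≢x⇒w∈exchange x∈S x≢x₀)

  spanning-set-banning-z : ∀ {S} → z ∈ S → NoProperStalledSuperset G ∅ S →
    ∃[ S₁ ] (z ∈ S₁ × ∣ S₁ ∣ ≤ ∣ S ∣ × NoProperStalledSuperset G ｛ z ｝ S₁)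
  spanning-set-banning-z {S} z∈S spans with stallingSequence G (z ≟_) S
  ... | fs , valid , avoid , stalled with all? (_∈? finalFilled G S fs)
  ...   | yes full    =
    S , z∈S , ≤-refl , fullSequence⇒noProperStalledSuperset G (fs , valid , avoid , full)
  ...   | no  notFull =
    let (z′∉F , T-z′⊆F) = stall-misses-only-z′ z∈S spans (_∈? _) stalled (⊆-finalFilled G fs) notFull
        T-twins⊆S = T-twins⊆initial fs valid avoid stalled z′∉F T-z′⊆F
    in exchange S x₀ z′ , w∈p∧w≢x⇒w∈exchange z∈S (≢-sym x₀≢z) ,
       ∣exchange∣≤∣p∣ z′ (T-twins⊆S x₀∈T x₀≢z x₀≢z′) , exchange-x₀ z∈S T-twins⊆S spans

proposition5p6 : ∀ {n : ℕ} (G : Graph n) (T : Subset n) (z : Fin n)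
    → IsClique G (λ x → x ∈ T)
    → z ∈ T
    → deg G z ≡ ∣ T ∣ ∸ 1
    → (∃[ z′ ] (z′ ∈ T × z′ ≢ z × deg G z′ ≡ ∣ T ∣ ∸ 1))
    → (∃[ x ] ∃[ y ] (x ∈ T × y ∉ T × Adj G x y))
    → (∀ x → x ∈ T →
         (∀ y → y ∉ T → ¬ Adj G x y)
         ⊎ IsClique G (λ y → y ∉ T × Adj G x y))
    → IsCritical G z
proposition5p6 G T z clique z∈T deg-z (z′ , z′∈T , z′≢z , deg-z′) (x₀ , y₀ , x₀∈T , y₀∉T , x₀y₀)
               outside-cliques =
  let (S₀ , zfs₀ , minimum) = optimalZFS G
      (S , z∈S , ∣S∣≤∣S₀∣ , spans) = twin-member G twins (zfs⇒noProperStalledSuperset G zfs₀)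
      (S₁ , z∈S₁ , ∣S₁∣≤∣S∣ , spans₁) = spanning-set-banning-z z∈S spans
      ∣S₁∣≤Z = λ S′ zfs′ → ≤-trans ∣S₁∣≤∣S∣ (≤-trans ∣S∣≤∣S₀∣ (minimum S′ zfs′))
  in noProperStalledSuperset⇒critical G z∈S₁ ∣S₁∣≤Z spans₁
  where
  N[z]⊆T : ∀ {y} → Adj G z y → y ∈ T
  N[z]⊆T = clique-degree⇒neighbours⊆ G clique z∈T deg-z
  N[z′]⊆T : ∀ {y} → Adj G z′ y → y ∈ T
  N[z′]⊆T = clique-degree⇒neighbours⊆ G clique z′∈T deg-z′
  x₀≢z : x₀ ≢ z
  x₀≢z refl = y₀∉T (N[z]⊆T x₀y₀)
  x₀≢z′ : x₀ ≢ z′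
  x₀≢z′ refl = y₀∉T (N[z′]⊆T x₀y₀)
  open TwinsInClique G clique z∈T z′∈T x₀∈T z′≢z x₀≢z x₀≢z′ N[z]⊆T N[z′]⊆T outside-cliques
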